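{- A connected finite graph $G$ is $d_0$-KP if and only if some nonempty induced subgraph $H$ of $G$ is $d_0$-KP (i.e. $d_H$-KP, where $d_H(v)$ is the degree of $v$ in $H$).
   Context: A kernel in a digraph $D$ is an independent set $I\subseteq V(D)$ such that every vertex outside $I$ has an arc into $I$; $D$ is kernel-perfect if every induced subdigraph has a kernel. For a graph $H$ and $f\colon V(H)\to\mathbb{N}$, $H$ is $f$-KP if there is a kernel-perfect digraph $H'$ on vertex set $V(H)$ which is an oriented supergraph of $H$ (every edge of $H$ appears in $H'$ as an arc in at least one direction; extra arcs, including both directions of an edge, are allowed) such that $f(v)>d^+_{H'}(v)$ for all $v\in V(H)$. For a graph $F$, $d_0$ denotes the function $v\mapsto d_F(v)$, so $F$ is $d_0$-KP means $F$ is $d_F$-KP. -}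

module Defs where

open import Data.Nat using (ℕ; zero; suc; _+_; _<_; _≤_)
open import Data.Fin using (Fin; zero; suc)
open import Data.Bool using (Bool; true; false; if_then_else_)
open import Data.Product using (Σ; _×_; _,_; ∃)
open import Data.Sum using (_⊎_)
open import Relation.Binary.PropositionalEquality using (_≡_; _≢_)
open import Function.Definitions using (Injective)

record Graph (n : ℕ) : Set where
  field
    adj   : Fin n → Fin n → Bool
    sym   : ∀ u v → adj u v ≡ adj v u
    irrefl : ∀ v → adj v v ≡ false
open Graph public

count : ∀ {n} → (Fin n → Bool) → ℕ
count {zero}  p = 0
count {suc n} p = (if p zero then 1 else 0) + count (λ i → p (suc i))

deg : ∀ {n} → Graph n → Fin n → ℕ
deg G v = count (adj G v)

data Reach {n} (G : Graph n) : Fin n → Fin n → Set where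
  here : ∀ {u} → Reach G u u
  step : ∀ {u w v} → adj G u w ≡ true → Reach G w v → Reach G u v

Connected : ∀ {n} → Graph n → Set
Connected {n} G = (0 < n) × (∀ u v → Reach G u v)

-- Induced subgraph on the image of an injection ι : Fin k → Fin n
induced : ∀ {n k} → (G : Graph n) → (Fin k → Fin n) → Graph k
induced G ι = record
  { adj = λ u v → adj G (ι u) (ι v)
  ; sym = λ u v → sym G (ι u) (ι v)
  ; irrefl = λ v → irrefl G (ι v) }

-- Digraphs on Fin n: arc u v means u → v
Digraph : ℕ → Set
Digraph n = Fin n → Fin n → Bool

Loopless : ∀ {n} → Digraph n → Set
Loopless D = ∀ v → D v v ≡ false

outdeg : ∀ {n} → Digraph n → Fin n → ℕ
outdeg D v = count (D v)

Subset : ℕ → Set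
Subset n = Fin n → Bool

IsKernelIn : ∀ {n} → Digraph n → Subset n → Subset n → Set
IsKernelIn D S I =
    (∀ v → I v ≡ true → S v ≡ true)
  × (∀ u v → I u ≡ true → I v ≡ true → D u v ≡ false)
  × (∀ v → S v ≡ true → I v ≡ false → ∃ λ w → I w ≡ true × D v w ≡ true)

KernelPerfect : ∀ {n} → Digraph n → Set
KernelPerfect {n} D = ∀ (S : Subset n) → ∃ λ (I : Subset n) → IsKernelIn D S I

OrientedSuper : ∀ {n} → Graph n → Digraph n → Set
OrientedSuper H D = ∀ u v → adj H u v ≡ true → (D u v ≡ true) ⊎ (D v u ≡ true)

_-KP_ : ∀ {n} → (Fin n → ℕ) → Graph n → Set
_-KP_ {n} f H = ∃ λ (D : Digraph n) →
  Loopless D × OrientedSuper H D × KernelPerfect D × (∀ v → outdeg D v < f v)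

d₀-KP : ∀ {n} → Graph n → Set
d₀-KP H = deg H -KP H

-- If an induced subgraph H has a kernel-perfect orientation D with d⁺_D < d_H, extend D to
-- all of G: edges leaving H point away from H, and the remaining edges point upwards in a
-- linear order that refines the distance to H (which is finite since G is connected). Every
-- vertex outside H has a neighbour closer to H, so it loses at least one out-arc, while a
-- vertex of H keeps its deficit from D. Outside H the new arcs only go upwards, so in any
-- vertex set the highest vertex outside H is a sink; adding it to a kernel of what remains
-- after deleting it and its in-neighbours reduces kernel-perfectness to that of D.
module Submission where

open import Defs hiding (sym)
open import Algebra.Properties.CommutativeSemigroup using (x∙yz≈y∙xz)
open import Data.Bool using (Bool; true; false; if_then_else_; _∧_; _∨_; not)
open import Data.Bool.Properties using (∧-conicalˡ; ∧-conicalʳ)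
import Data.Bool.Properties as Bool
open import Data.Fin using (Fin; zero; suc; toℕ)
open import Data.Fin.Properties
  using (_≟_; any?; 0≢1+n; suc-injective; toℕ-injective; toℕ<n; nonZeroIndex)
open import Data.Nat using (ℕ; zero; suc; _+_; _*_; _<_; _<ᵇ_; _≤_; z≤n; s≤s; s≤s⁻¹; _⊔_)
open import Data.Nat.DivMod using (_%_; m<n⇒m%n≡m; [m+kn]%n≡m%n)
open import Data.Nat.Properties
  using ( ≤-refl; ≤-trans; <-irrefl; <-asym; <-cmp; n≮0; ≤∧≢⇒<; <⇒≱; m≤m⊔n; m≤n⊔m; m≤n+m
        ; +-assoc; +-mono-≤; +-mono-≤-<; +-monoˡ-<; *-monoˡ-≤; <ᵇ⇒<; <⇒<ᵇ
        ; +-commutativeSemigroup; module ≤-Reasoning)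
import Data.Nat.Properties as ℕ
open import Data.Product using (Σ; _×_; _,_; ∃; proj₁; proj₂)
open import Data.Sum using (_⊎_; inj₁; inj₂)
open import Function using (id; _∘_; case_of_)
open import Function.Bundles using (_⇔_; mk⇔; Equivalence)
open import Function.Definitions using (Injective)
open import Relation.Binary.Definitions using (tri<; tri≈; tri>)
open import Relation.Binary.PropositionalEquality
open import Relation.Nullary using (¬_; Dec; yes; no; does; contradiction)
open import Relation.Nullary.Decidable using (dec-true; dec-false; ¬?; _×-dec_; decidable-stable)

_⊆_ : ∀ {n} → Subset n → Subset n → Set
P ⊆ Q = ∀ i → P i ≡ true → Q i ≡ true

count-cong : ∀ {n} {P Q : Subset n} → (∀ i → P i ≡ Q i) → count P ≡ count Q
count-cong {zero}  P≗Q = refl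
count-cong {suc n} P≗Q =
  cong₂ _+_ (cong (λ b → if b then 1 else 0) (P≗Q zero)) (count-cong (P≗Q ∘ suc))

count-≡0 : ∀ {n} (P : Subset n) → (∀ i → P i ≡ false) → count P ≡ 0
count-≡0 {zero}  P P≡false = refl
count-≡0 {suc n} P P≡false rewrite P≡false zero = count-≡0 (P ∘ suc) (P≡false ∘ suc)

indicator-mono : ∀ {a b} → (a ≡ true → b ≡ true) → (if a then 1 else 0) ≤ (if b then 1 else 0)
indicator-mono {false} _   = z≤n
indicator-mono {true}  a⇒b rewrite a⇒b refl = ≤-refl

count-mono : ∀ {n} {P Q : Subset n} → P ⊆ Q → count P ≤ count Q
count-mono {zero}  P⊆Q = z≤n
count-mono {suc n} P⊆Q = +-mono-≤ (indicator-mono (P⊆Q zero)) (count-mono (P⊆Q ∘ suc))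

count-< : ∀ {n} {P Q : Subset n} → P ⊆ Q → ∀ i → Q i ≡ true → P i ≡ false → count P < count Q
count-< {suc n} P⊆Q zero    Qi Pi rewrite Qi | Pi = s≤s (count-mono (P⊆Q ∘ suc))
count-< {suc n} P⊆Q (suc i) Qi Pi =
  +-mono-≤-< (indicator-mono (P⊆Q zero)) (count-< (P⊆Q ∘ suc) i Qi Pi)

count-partition : ∀ {n} (H P : Subset n) →
  count P ≡ count (λ i → H i ∧ P i) + count (λ i → not (H i) ∧ P i)
count-partition {zero}  H P = refl
count-partition {suc n} H P =
  trans (cong (P₀ +_) (count-partition (H ∘ suc) (P ∘ suc))) (shuffle (H zero))
  where
  P₀ A B : ℕ
  P₀ = if P zero then 1 else 0
  A  = count (λ i → H (suc i) ∧ P (suc i))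
  B  = count (λ i → not (H (suc i)) ∧ P (suc i))
  shuffle : ∀ h → P₀ + (A + B) ≡
    ((if h ∧ P zero then 1 else 0) + A) + ((if not h ∧ P zero then 1 else 0) + B)
  shuffle true  = sym (+-assoc P₀ A B)
  shuffle false = x∙yz≈y∙xz +-commutativeSemigroup P₀ A B

count-remove : ∀ {n} (P : Subset n) w →
  count P ≡ (if P w then 1 else 0) + count (λ i → not (does (i ≟ w)) ∧ P i)
count-remove {suc n} P zero    = refl
count-remove {suc n} P (suc w) =
  trans (cong (P₀ +_) (count-remove (P ∘ suc) w))
        (x∙yz≈y∙xz +-commutativeSemigroup P₀ (if P (suc w) then 1 else 0) _)
  where
  P₀ : ℕ
  P₀ = if P zero then 1 else 0

count-image : ∀ {k n} {ι : Fin k → Fin n} → Injective _≡_ _≡_ ι → (P : Subset n) →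
  (∀ w → P w ≡ true → ∃ λ a → ι a ≡ w) → count P ≡ count (P ∘ ι)
count-image {zero} ι-inj P P⊆ι = count-≡0 P P≡false
  where
  P≡false : ∀ w → P w ≡ false
  P≡false w with P w in Pw
  ... | true  with () ← P⊆ι w Pw
  ... | false = refl
count-image {suc k} {ι = ι} ι-inj P P⊆ι =
  trans (count-remove P (ι zero))
        (cong (_ +_) (trans (count-image (suc-injective ∘ ι-inj) P′ P′⊆ι) (count-cong P′≗P)))
  where
  P′ : Subset _
  P′ i = not (does (i ≟ ι zero)) ∧ P i
  P′⊆ι : ∀ w → P′ w ≡ true → ∃ λ a → ι (suc a) ≡ w
  P′⊆ι w P′w with P⊆ι w (∧-conicalʳ _ _ P′w)
  ... | suc a , refl = a , refl
  ... | zero  , refl rewrite dec-true (ι zero ≟ ι zero) refl with () ← P′w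
  P′≗P : ∀ a → P′ (ι (suc a)) ≡ P (ι (suc a))
  P′≗P a rewrite dec-false (ι (suc a) ≟ ι zero) (0≢1+n ∘ sym ∘ ι-inj) = refl

upper-bound : ∀ {n} (f : Fin n → ℕ) → ∃ λ B → ∀ i → f i < B
upper-bound {zero}  f = 0 , λ ()
upper-bound {suc n} f with upper-bound (f ∘ suc)
... | B , f<B = suc (f zero) ⊔ B , λ where
  zero    → m≤m⊔n (suc (f zero)) B
  (suc i) → ≤-trans (f<B i) (m≤n⊔m (suc (f zero)) B)

-- The least j ≤ N with p j, or N if there is none.
least : (ℕ → Bool) → ℕ → ℕ
least p zero    = zero
least p (suc N) = if p zero then zero else suc (least (p ∘ suc) N)

least-satisfies : ∀ (p : ℕ → Bool) N → p N ≡ true → p (least p N) ≡ true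
least-satisfies p zero    pN = pN
least-satisfies p (suc N) pN with p zero in p0
... | true  = p0
... | false = least-satisfies (p ∘ suc) N pN

least-≤ : ∀ (p : ℕ → Bool) N j → p j ≡ true → least p N ≤ j
least-≤ p zero    j       pj = z≤n
least-≤ p (suc N) j       pj with p zero in p0
... | true  = z≤n
least-≤ p (suc N) zero    pj | false with () ← trans (sym pj) p0
least-≤ p (suc N) (suc j) pj | false = s≤s (least-≤ (p ∘ suc) N j pj)

module _ {n} (D : Digraph n) where

  removeInNeighbourhood : Subset n → Fin n → Subset n
  removeInNeighbourhood S v w = not (does (w ≟ v)) ∧ (not (D w v) ∧ S w)

  insert : Fin n → Subset n → Subset n
  insert v I w = does (w ≟ v) ∨ I w

  removeInNeighbourhood-⊆ : ∀ {S} v → removeInNeighbourhood S v ⊆ S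
  removeInNeighbourhood-⊆ {S} v w e =
    ∧-conicalʳ (not (D w v)) (S w) (∧-conicalʳ (not (does (w ≟ v))) _ e)

  removeInNeighbourhood-↛ : ∀ {S} v w → removeInNeighbourhood S v w ≡ true → D w v ≡ false
  removeInNeighbourhood-↛ {S} v w e =
    Bool.not-injective (∧-conicalˡ (not (D w v)) (S w) (∧-conicalʳ (not (does (w ≟ v))) _ e))

  removeInNeighbourhood-≢ : ∀ {S} v w → removeInNeighbourhood S v w ≡ true → w ≢ v
  removeInNeighbourhood-≢ v w e w≡v with w ≟ v
  ... | yes _  with () ← e
  ... | no w≢v = w≢v w≡v

  ∈removeInNeighbourhood : ∀ {S v x} → x ≢ v → D x v ≡ false → S x ≡ true →
    removeInNeighbourhood S v x ≡ true
  ∈removeInNeighbourhood {v = v} {x} x≢v Dxv Sx rewrite dec-false (x ≟ v) x≢v | Dxv = Sx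

  kernel-insert-sink : ∀ {S I} v → S v ≡ true → (∀ w → S w ≡ true → D v w ≡ false) →
    IsKernelIn D (removeInNeighbourhood S v) I → IsKernelIn D S (insert v I)
  kernel-insert-sink {S} {I} v Sv sink (I⊆S′ , independent , absorbing) =
    ⊆S , independent′ , absorbing′
    where
    I⊆S : I ⊆ S
    I⊆S w Iw = removeInNeighbourhood-⊆ {S} v w (I⊆S′ w Iw)
    ⊆S : insert v I ⊆ S
    ⊆S w e with w ≟ v
    ... | yes refl = Sv
    ... | no _     = I⊆S w e
    independent′ : ∀ u w → insert v I u ≡ true → insert v I w ≡ true → D u w ≡ false
    independent′ u w Iu Iw with u ≟ v | w ≟ v
    ... | yes refl | yes refl = sink v Sv
    ... | yes refl | no _     = sink w (I⊆S w Iw)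
    ... | no _     | yes refl = removeInNeighbourhood-↛ {S} v u (I⊆S′ u Iu)
    ... | no _     | no _     = independent u w Iu Iw
    absorbing′ : ∀ x → S x ≡ true → insert v I x ≡ false →
      ∃ λ w → insert v I w ≡ true × D x w ≡ true
    absorbing′ x Sx Ix with x ≟ v | D x v in Dxv
    ... | yes refl | _     with () ← Ix
    ... | no _     | true  = v , cong (_∨ I v) (dec-true (v ≟ v) refl) , Dxv
    ... | no x≢v   | false with absorbing x (∈removeInNeighbourhood {S} x≢v Dxv Sx) Ix
    ... | w , Iw , Dxw = w , trans (cong (does (w ≟ v) ∨_) Iw) (Bool.∨-zeroʳ _) , Dxw

kernelPerfect-byRank : ∀ {n} (D : Digraph n) {Inner : Fin n → Set} → (∀ v → Dec (Inner v)) →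
  (rank : Fin n → ℕ) → Injective _≡_ _≡_ rank →
  (∀ {u w} → ¬ Inner u → D u w ≡ true → ¬ Inner w × rank u < rank w) →
  (∀ S → (∀ w → S w ≡ true → Inner w) → ∃ (IsKernelIn D S)) →
  KernelPerfect D
kernelPerfect-byRank {n} D {Inner} inner? rank rank-inj ascending inner-kernel S
  with upper-bound rank
... | B , rank<B = kernel-below B S (λ w _ _ → rank<B w)
  where
  kernel-below : ∀ m S → (∀ w → S w ≡ true → ¬ Inner w → rank w < m) → ∃ (IsKernelIn D S)
  kernel-below zero S bounded =
    inner-kernel S (λ w Sw → decidable-stable (inner? w) (λ ∉inner → n≮0 (bounded w Sw ∉inner)))
  kernel-below (suc m) S bounded
    with any? (λ v → (S v Bool.≟ true) ×-dec ¬? (inner? v) ×-dec (rank v ℕ.≟ m))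
  ... | no none = kernel-below m S bounded′
    where
    bounded′ : ∀ w → S w ≡ true → ¬ Inner w → rank w < m
    bounded′ w Sw ∉inner =
      ≤∧≢⇒< (s≤s⁻¹ (bounded w Sw ∉inner)) (λ eq → none (w , Sw , ∉inner , eq))
  ... | yes (v , Sv , ∉inner , rank-v≡m) with kernel-below m S′ bounded′
    where
    S′ : Subset n
    S′ = removeInNeighbourhood D S v
    bounded′ : ∀ w → S′ w ≡ true → ¬ Inner w → rank w < m
    bounded′ w S′w ∉inner-w =
      ≤∧≢⇒< (s≤s⁻¹ (bounded w (removeInNeighbourhood-⊆ D {S} v w S′w) ∉inner-w))
            (λ rank-w≡m → removeInNeighbourhood-≢ D {S} v w S′w
                            (rank-inj (trans rank-w≡m (sym rank-v≡m))))
  ... | I , I-kernel = insert D v I , kernel-insert-sink D v Sv sink I-kernel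
    where
    sink : ∀ w → S w ≡ true → D v w ≡ false
    sink w Sw with D v w in Dvw
    ... | false = refl
    ... | true  with ascending ∉inner Dvw
    ... | ∉inner-w , v<w =
      contradiction (bounded w Sw ∉inner-w) (<⇒≱ (s≤s (subst (_< rank w) rank-v≡m v<w)))

module Embedding {k n} {ι : Fin k → Fin n} (ι-inj : Injective _≡_ _≡_ ι) where

  InImage : Fin n → Set
  InImage w = ∃ λ a → ι a ≡ w

  preimage : ∀ w → Dec (InImage w)
  preimage w = any? (λ a → ι a ≟ w)

  inImage : Subset n
  inImage w = does (preimage w)

  inImage-ι : ∀ a → inImage (ι a) ≡ true
  inImage-ι a = dec-true (preimage (ι a)) (a , refl)

  extend : Subset k → Subset n
  extend P w with preimage w
  ... | yes (a , _) = P a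
  ... | no _        = false

  extend-ι : ∀ P a → extend P (ι a) ≡ P a
  extend-ι P a with preimage (ι a)
  ... | yes (b , ιb≡ιa) = cong P (ι-inj ιb≡ιa)
  ... | no ∉ι           = contradiction (a , refl) ∉ι

  extend-true : ∀ P w → extend P w ≡ true → ∃ λ a → ι a ≡ w × P a ≡ true
  extend-true P w Pw with preimage w
  ... | yes (a , ιa≡w) = a , ιa≡w , Pw

  count-split-image : (P : Subset n) →
    count P ≡ count (P ∘ ι) + count (λ w → not (inImage w) ∧ P w)
  count-split-image P =
    trans (count-partition inImage P)
          (cong (_+ count (λ w → not (inImage w) ∧ P w))
                (trans (count-image ι-inj _ inside)
                       (count-cong (λ a → cong (_∧ P (ι a)) (inImage-ι a)))))
    where
    inside : ∀ w → inImage w ∧ P w ≡ true → InImage w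
    inside w e with preimage w
    ... | yes ιa≡w = ιa≡w

  kernel-in-image : ∀ (E : Digraph n) (D : Digraph k) → (∀ a b → E (ι a) (ι b) ≡ D a b) →
    KernelPerfect D → ∀ S → (∀ w → S w ≡ true → InImage w) → ∃ (IsKernelIn E S)
  kernel-in-image E D E≗D kp S S⊆ι with kp (S ∘ ι)
  ... | I , I⊆S , independent , absorbing = extend I , ⊆S , independent′ , absorbing′
    where
    ⊆S : extend I ⊆ S
    ⊆S w Iw with extend-true I w Iw
    ... | a , refl , Ia = I⊆S a Ia
    independent′ : ∀ u w → extend I u ≡ true → extend I w ≡ true → E u w ≡ false
    independent′ u w Iu Iw with extend-true I u Iu | extend-true I w Iw
    ... | a , refl , Ia | b , refl , Ib = trans (E≗D a b) (independent a b Ia Ib)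
    absorbing′ : ∀ v → S v ≡ true → extend I v ≡ false →
      ∃ λ w → extend I w ≡ true × E v w ≡ true
    absorbing′ v Sv Iv with S⊆ι v Sv
    ... | a , refl with absorbing a Sv (trans (sym (extend-ι I a)) Iv)
    ... | b , Ib , Dab = ι b , trans (extend-ι I b) Ib , trans (E≗D a b) Dab

Descending : ∀ {n} → Graph n → (Fin n → Set) → (Fin n → ℕ) → Set
Descending G Target r = ∀ v → ¬ Target v → ∃ λ w → adj G v w ≡ true × r w < r v

walk-length : ∀ {n} {G : Graph n} {u v} → Reach G u v → ℕ
walk-length here       = 0
walk-length (step _ p) = suc (walk-length p)

module _ {n} (G : Graph n) {Target : Fin n → Set} (target? : ∀ v → Dec (Target v)) where

  within : ℕ → Subset n
  within zero    v = does (target? v)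
  within (suc j) v = within j v ∨ does (any? λ w → adj G v w ∧ within j w Bool.≟ true)

  within-walk : ∀ {v t} (p : Reach G v t) → Target t → within (walk-length p) v ≡ true
  within-walk {t = t} here t∈ = dec-true (target? t) t∈
  within-walk {v} (step {w = w} vw p) t∈ =
    trans (cong (within ℓ v ∨_) (dec-true (any? _) (w , step-into-layer)))
          (Bool.∨-zeroʳ (within ℓ v))
    where
    ℓ : ℕ
    ℓ = walk-length p
    step-into-layer : adj G v w ∧ within ℓ w ≡ true
    step-into-layer = trans (cong (_∧ within ℓ w) vw) (within-walk p t∈)

  within-suc : ∀ v j → within (suc j) v ≡ true →
    within j v ≡ true ⊎ ∃ λ w → adj G v w ≡ true × within j w ≡ true
  within-suc v j e with within j v | any? (λ w → adj G v w ∧ within j w Bool.≟ true)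
  ... | true  | _            = inj₁ refl
  ... | false | yes (w , e′) = inj₂ (w , ∧-conicalˡ _ _ e′ , ∧-conicalʳ _ _ e′)

  descending-rank : (∀ v → ∃ λ t → Target t × Reach G v t) → ∃ (Descending G Target)
  descending-rank reach = distance , λ v ∉target →
    descend v (distance v) (within-distance v) (distance-≤ v) ∉target
    where
    bound : Fin n → ℕ
    bound v with reach v
    ... | _ , _ , p = walk-length p
    distance : Fin n → ℕ
    distance v = least (λ j → within j v) (bound v)
    within-distance : ∀ v → within (distance v) v ≡ true
    within-distance v with reach v
    ... | _ , t∈ , p = least-satisfies (λ j → within j v) (walk-length p) (within-walk p t∈)
    distance-≤ : ∀ v j → within j v ≡ true → distance v ≤ j
    distance-≤ v = least-≤ (λ j → within j v) (bound v)
    descend : ∀ v j → within j v ≡ true → (∀ i → within i v ≡ true → j ≤ i) → ¬ Target v →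
      ∃ λ w → adj G v w ≡ true × distance w < j
    descend v zero    e _       ∉target with target? v
    ... | yes t∈ = contradiction t∈ ∉target
    descend v (suc j) e minimal ∉target with within-suc v j e
    ... | inj₁ ej             = contradiction (minimal j ej) (<-irrefl refl)
    ... | inj₂ (w , vw , ej′) = w , vw , s≤s (distance-≤ w j ej′)

module _ {n} (r : Fin n → ℕ) where

  -- Orders the vertices lexicographically by (r v, v).
  lexKey : Fin n → ℕ
  lexKey v = toℕ v + r v * n

  lexKey-injective : Injective _≡_ _≡_ lexKey
  lexKey-injective {u} {w} eq = toℕ-injective (begin
    toℕ u         ≡⟨ m<n⇒m%n≡m (toℕ<n u) ⟨
    toℕ u % n     ≡⟨ [m+kn]%n≡m%n (toℕ u) (r u) n ⟨
    lexKey u % n  ≡⟨ cong (_% n) eq ⟩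
    lexKey w % n  ≡⟨ [m+kn]%n≡m%n (toℕ w) (r w) n ⟩
    toℕ w % n     ≡⟨ m<n⇒m%n≡m (toℕ<n w) ⟩
    toℕ w         ∎)
    where
    open ≡-Reasoning
    instance _ = nonZeroIndex u

  lexKey-mono : ∀ {u w} → r u < r w → lexKey u < lexKey w
  lexKey-mono {u} {w} ru<rw = begin-strict
    toℕ u + r u * n  <⟨ +-monoˡ-< (r u * n) (toℕ<n u) ⟩
    suc (r u) * n    ≤⟨ *-monoˡ-≤ n ru<rw ⟩
    r w * n          ≤⟨ m≤n+m (r w * n) (toℕ w) ⟩
    lexKey w         ∎
    where open ≤-Reasoning

module Extension {n k} (G : Graph n) {ι : Fin k → Fin n} (ι-inj : Injective _≡_ _≡_ ι)
                 (D : Digraph k) (r : Fin n → ℕ) where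

  open Embedding ι-inj

  arc : Digraph n
  arc u w with preimage u | preimage w
  ... | yes (a , _) | yes (b , _) = D a b
  ... | yes _       | no _        = adj G u w
  ... | no _        | yes _       = false
  ... | no _        | no _        = (lexKey r u <ᵇ lexKey r w) ∧ adj G u w

  arc-ι : ∀ a b → arc (ι a) (ι b) ≡ D a b
  arc-ι a b with preimage (ι a) | preimage (ι b)
  ... | yes (_ , ιa′≡ιa) | yes (_ , ιb′≡ιb) = cong₂ D (ι-inj ιa′≡ιa) (ι-inj ιb′≡ιb)
  ... | no ∉ι | _     = contradiction (a , refl) ∉ι
  ... | _     | no ∉ι = contradiction (b , refl) ∉ι

  arc-outside : ∀ {u w} → ¬ InImage u → arc u w ≡ true →
    adj G u w ≡ true × ¬ InImage w × lexKey r u < lexKey r w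
  arc-outside {u} {w} ∉ι e with preimage u | preimage w
  ... | yes u∈ | _      = contradiction u∈ ∉ι
  ... | no _   | no ∉ιw with lexKey r u <ᵇ lexKey r w in u<ᵇw
  ...   | true = e , ∉ιw , <ᵇ⇒< _ _ (Equivalence.from Bool.T-≡ u<ᵇw)

  arc-loopless : Loopless D → Loopless arc
  arc-loopless loopless v with preimage v
  ... | yes (a , refl) = loopless a
  ... | no _           = trans (cong (_ ∧_) (irrefl G v)) (Bool.∧-zeroʳ _)

  arc-super : OrientedSuper (induced G ι) D → OrientedSuper G arc
  arc-super super u w uw with preimage u | preimage w
  ... | yes (a , refl) | yes (b , refl) = super a b uw
  ... | yes _          | no _           = inj₁ uw
  ... | no _           | yes _          = inj₂ (trans (Graph.sym G w u) uw)
  ... | no _           | no _           with <-cmp (lexKey r u) (lexKey r w)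
  ...   | tri< u<w _ _ = inj₁ (cong₂ _∧_ (Equivalence.to Bool.T-≡ (<⇒<ᵇ u<w)) uw)
  ...   | tri> _ _ w<u =
    inj₂ (cong₂ _∧_ (Equivalence.to Bool.T-≡ (<⇒<ᵇ w<u)) (trans (Graph.sym G w u) uw))
  ...   | tri≈ _ u≈w _
    with () ← trans (sym uw) (trans (cong (adj G u) (sym (lexKey-injective r u≈w))) (irrefl G u))

  outside : Subset n → ℕ
  outside P = count (λ w → not (inImage w) ∧ P w)

  arc-outdeg-ι : (∀ a → outdeg D a < deg (induced G ι) a) → ∀ a → outdeg arc (ι a) < deg G (ι a)
  arc-outdeg-ι outdeg< a = begin-strict
    outdeg arc (ι a)                             ≡⟨ count-split-image (arc (ι a)) ⟩
    count (arc (ι a) ∘ ι) + outside (arc (ι a))  ≡⟨ cong₂ _+_ (count-cong (arc-ι a))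
                                                              (count-cong same-outside) ⟩
    outdeg D a + outside (adj G (ι a))           <⟨ +-monoˡ-< _ (outdeg< a) ⟩
    deg (induced G ι) a + outside (adj G (ι a))  ≡⟨ count-split-image (adj G (ι a)) ⟨
    deg G (ι a)                                  ∎
    where
    open ≤-Reasoning
    same-outside : ∀ w → not (inImage w) ∧ arc (ι a) w ≡ not (inImage w) ∧ adj G (ι a) w
    same-outside w with preimage (ι a) | preimage w
    ... | yes _  | yes _ = refl
    ... | yes _  | no _  = refl
    ... | no ∉ιa | _     = contradiction (a , refl) ∉ιa

  arc-outdeg-outside : Descending G InImage r → ∀ {u} → ¬ InImage u → outdeg arc u < deg G u
  arc-outdeg-outside descends {u} ∉ι with descends u ∉ι
  ... | w , uw , rw<ru = count-< (λ x → proj₁ ∘ arc-outside ∉ι) w uw ¬arc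
    where
    ¬arc : arc u w ≡ false
    ¬arc with arc u w in e
    ... | false = refl
    ... | true  = contradiction (proj₂ (proj₂ (arc-outside ∉ι e))) (<-asym (lexKey-mono r rw<ru))

  arc-outdeg : (∀ a → outdeg D a < deg (induced G ι) a) → Descending G InImage r →
    ∀ u → outdeg arc u < deg G u
  arc-outdeg outdeg< descends u = case preimage u of λ where
    (yes (a , refl)) → arc-outdeg-ι outdeg< a
    (no ∉ι)          → arc-outdeg-outside descends ∉ι

  arc-kernelPerfect : KernelPerfect D → KernelPerfect arc
  arc-kernelPerfect kp =
    kernelPerfect-byRank arc preimage (lexKey r) (lexKey-injective r)
      (λ ∉ι e → proj₂ (arc-outside ∉ι e))
      (kernel-in-image arc D arc-ι kp)

d₀-KP-from-induced : ∀ {n k} (G : Graph n) {ι : Fin k → Fin n} → Injective _≡_ _≡_ ι →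
  (∀ v → ∃ λ a → Reach G v (ι a)) → d₀-KP (induced G ι) → d₀-KP G
d₀-KP-from-induced G {ι} ι-inj reach (D , loopless , super , kp , outdeg<)
  with descending-rank G preimage (λ v → let a , p = reach v in ι a , (a , refl) , p)
  where open Embedding ι-inj
... | r , descends =
  arc , arc-loopless loopless , arc-super super , arc-kernelPerfect kp , arc-outdeg outdeg< descends
  where open Extension G ι-inj D r

lemma6p7 : ∀ {n} (G : Graph n) → Connected G →
    d₀-KP G ⇔ (∃ λ (k : ℕ) → 0 < k × (Σ (Fin k → Fin n) λ ι →
      Injective _≡_ _≡_ ι × d₀-KP (induced G ι)))
lemma6p7 {n} G (0<n , connected) = mk⇔
  (λ G-KP → n , 0<n , id , (λ {_} {_} → id) , G-KP)
  λ { (suc k , _ , ι , ι-inj , H-KP) →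
        d₀-KP-from-induced G ι-inj (λ v → zero , connected v (ι zero)) H-KP }
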